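{- For every finite poset $P$, $\mathrm{La}^*_R(n,P)\ge (\mathrm{re}^*(P)+o(1))\binom{n}{\lfloor n/2\rfloor}$ as $n\to\infty$.
   Context: A subfamily of a family of sets is a copy of a poset $P$ if, ordered by inclusion, it is isomorphic to $P$. A coloring of a family of sets is proper if $F\subsetneq F'$ implies $F,F'$ get different colors; a copy is rainbow if its members get pairwise distinct colors. $\mathrm{La}^*_R(n,P)$ is the maximum size of a family $\mathcal{F}\subseteq 2^{[n]}$ admitting a proper coloring with no rainbow copy of $P$. $\mathrm{re}^*(P)$ is the maximum positive integer $k$ such that for every $n$, the union of the $k$ middle layers of $2^{[n]}$ contains no copy of $P$ all of whose elements are taken from distinct layers. -}

module Defs where

open import Data.Nat using (ℕ; zero; suc; _+_; _*_; _∸_; _≤_; _<_)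
open import Data.Nat.DivMod using (_/_)
open import Data.Fin using (Fin)
open import Data.Fin.Subset using (Subset; _⊆_; ∣_∣)
open import Data.List using (List; length)
open import Data.List.Membership.Propositional using (_∈_)
open import Data.List.Relation.Unary.Unique.Propositional using (Unique)
open import Data.Product using (Σ; ∃; _×_; _,_)
open import Relation.Binary.PropositionalEquality using (_≡_)
open import Relation.Nullary using (¬_)
open import Function.Definitions using (Injective)
open import Function.Bundles using (_⇔_)

record FinPoset : Set₁ where
  field
    size   : ℕ
    _≼_    : Fin size → Fin size → Set
    refl≼  : ∀ {i} → i ≼ i
    antisym≼ : ∀ {i j} → i ≼ j → j ≼ i → i ≡ j
    trans≼ : ∀ {i j k} → i ≼ j → j ≼ k → i ≼ k
open FinPoset public

record Family (n : ℕ) : Set where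
  field
    members : List (Subset n)
    distinct : Unique members
open Family public

∣_∣F : ∀ {n} → Family n → ℕ
∣ F ∣F = length (members F)

_⊊_ : ∀ {n} → Subset n → Subset n → Set
A ⊊ B = A ⊆ B × ¬ (A ≡ B)

IsCopy : ∀ {n} (P : FinPoset) (S : Subset n → Set) → (Fin (size P) → Subset n) → Set
IsCopy P S f =
  Injective _≡_ _≡_ f
  × (∀ i → S (f i))
  × (∀ i j → (_≼_ P i j ⇔ (f i ⊆ f j)))

-- Colorings (of all subsets; only values on the family matter).
Coloring : ℕ → Set
Coloring n = Subset n → ℕ

Proper : ∀ {n} → Family n → Coloring n → Set
Proper F c = ∀ {A B} → A ∈ members F → B ∈ members F → A ⊊ B → ¬ (c A ≡ c B)

Rainbow : ∀ {n} {p} → Coloring n → (Fin p → Subset n) → Set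
Rainbow c f = Injective _≡_ _≡_ (λ i → c (f i))

Admissible : ∀ {n} → FinPoset → Family n → Set
Admissible {n} P F =
  Σ (Coloring n) λ c → Proper F c ×
    (∀ f → IsCopy P (λ A → A ∈ members F) f → ¬ Rainbow c f)

IsLaStar : ℕ → FinPoset → ℕ → Set
IsLaStar n P L =
  (Σ (Family n) λ F → Admissible P F × ∣ F ∣F ≡ L)
  × (∀ (F : Family n) → Admissible P F → ∣ F ∣F ≤ L)

-- The k middle layers of 2^[n]: the layers of sizes i with
-- s ≤ i < s + k, where s = ⌊(n + 1 - k)/2⌋ (truncated at 0;
-- if k ≥ n+1 this is all of 2^[n]).
InMiddleLayers : ∀ (k n : ℕ) → Subset n → Set
InMiddleLayers k n A = ((n + 1 ∸ k) / 2 ≤ ∣ A ∣) × (∣ A ∣ < (n + 1 ∸ k) / 2 + k)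

LayeredCopy : FinPoset → ℕ → ℕ → Set
LayeredCopy P k n =
  Σ (Fin (size P) → Subset n) λ f →
    IsCopy P (InMiddleLayers k n) f × Injective _≡_ _≡_ (λ i → ∣ f i ∣)

ReGood : FinPoset → ℕ → Set
ReGood P k = ∀ n → ¬ LayeredCopy P k n

IsReStar : FinPoset → ℕ → Set
IsReStar P k = (1 ≤ k) × ReGood P k × (∀ k' → 1 ≤ k' → ReGood P k' → k' ≤ k)

{-# OPTIONS --safe #-}
module Submission where

-- Colour the r = re*(P) middle layers of 2^[n] by cardinality.  Strict inclusion
-- changes the cardinality, so the colouring is proper, and a rainbow copy of P would
-- be a copy with elements in distinct middle layers, which re*(P) rules out.  Hence
-- La*_R(n,P) is at least the total size of these layers.  From
--   (n+1) C(n,k+1) = (n+1) C(n,k) + (n-2k-1) (C(n,k) + C(n,k+1))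
-- and unimodality, each layer within distance r of n/2 has size at least
-- (1 - 4r²/(n+1)) C(n,⌊n/2⌋), which gives the bound once n+1 ≥ 4(m+1)r³.

open import Defs
open import Data.Nat using (ℕ; zero; suc; _+_; _*_; _∸_; _≤_; _<_; z≤n; s≤s; s≤s⁻¹)
open import Data.Nat.Properties
open import Data.Nat.DivMod using (_/_; _%_; m/n*n≤m; m≡m%n+[m/n]*n; m%n<n)
open import Data.Nat.Combinatorics using (_C_; nC1≡n; nCk+nC[k+1]≡[n+1]C[k+1]; nCk≡nC[n∸k])
open import Data.Nat.Tactic.RingSolver using (solve-∀)
open import Data.Vec using ([]; _∷_; here)
open import Data.Vec.Properties using (∷-injectiveʳ)
open import Data.Fin.Subset using (Subset; _⊆_; ∣_∣; ⊥; inside; outside)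
open import Data.Fin.Subset.Properties using (p⊆q⇒∣p∣≤∣q∣; drop-∷-⊆; ∣⊥∣≡0)
open import Data.List using (List; []; _∷_; _++_; map; length)
open import Data.List.Properties using (length-++; length-map)
open import Data.List.Membership.Propositional using (_∈_)
open import Data.List.Membership.Propositional.Properties using (∈-map⁻; ∈-++⁻)
open import Data.List.Relation.Unary.Any using (here)
open import Data.List.Relation.Unary.All using ([])
open import Data.List.Relation.Unary.AllPairs using ([]; _∷_)
open import Data.List.Relation.Unary.Unique.Propositional using (Unique)
import Data.List.Relation.Unary.Unique.Propositional.Properties as Unique
open import Data.Product using (∃; _×_; _,_)
open import Data.Sum using (inj₁; inj₂)
open import Relation.Binary.PropositionalEquality
open import Relation.Nullary using (¬_; yes; no; contradiction)

m+m≤1+n+n⇒m≤n : ∀ {m n} → m + m ≤ suc (n + n) → m ≤ n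
m+m≤1+n+n⇒m≤n {m} {n} le with m ≤? n
... | yes m≤n = m≤n
... | no m≰n = contradiction le (<⇒≱ (≤-trans (≤-reflexive (cong suc (sym (+-suc n n)))) (+-mono-≤ n<m n<m)))
  where
  n<m : n < m
  n<m = ≰⇒> m≰n

m*2≡m+m : ∀ h → h * 2 ≡ h + h
m*2≡m+m = solve-∀

m/2+m/2≤m : ∀ m → m / 2 + m / 2 ≤ m
m/2+m/2≤m m = subst (_≤ m) (m*2≡m+m (m / 2)) (m/n*n≤m m 2)

m≤1+m/2+m/2 : ∀ m → m ≤ suc (m / 2 + m / 2)
m≤1+m/2+m/2 m = begin
  m                       ≡⟨ m≡m%n+[m/n]*n m 2 ⟩
  m % 2 + m / 2 * 2       ≤⟨ +-mono-≤ (s≤s⁻¹ (m%n<n m 2)) (≤-reflexive (m*2≡m+m (m / 2))) ⟩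
  suc (m / 2 + m / 2)     ∎
  where open ≤-Reasoning

1+m+1+m≡2+m+m : ∀ m → suc m + suc m ≡ suc (suc (m + m))
1+m+1+m≡2+m+m m = cong suc (+-suc m m)

cancel-small-error : ∀ {a r S L c M q} → r * (suc a * c) ≤ suc a * S + q * c → M * q ≤ suc a → S ≤ L →
  M * r * c ≤ M * L + c
cancel-small-error {a} {r} {S} {L} {c} {M} {q} average Mq≤1+a S≤L = *-cancelˡ-≤ (suc a) (begin
  suc a * (M * r * c)                    ≡⟨ regroup₁ a M r c ⟩
  M * (r * (suc a * c))                  ≤⟨ *-monoʳ-≤ M average ⟩
  M * (suc a * S + q * c)                ≡⟨ regroup₂ a M S q c ⟩
  suc a * (M * S) + M * q * c            ≤⟨ +-mono-≤ (*-monoʳ-≤ (suc a) (*-monoʳ-≤ M S≤L)) (*-monoˡ-≤ c Mq≤1+a) ⟩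
  suc a * (M * L) + suc a * c            ≡⟨ sym (*-distribˡ-+ (suc a) (M * L) c) ⟩
  suc a * (M * L + c)                    ∎)
  where
  open ≤-Reasoning
  regroup₁ : ∀ a M r c → suc a * (M * r * c) ≡ M * (r * (suc a * c))
  regroup₁ = solve-∀
  regroup₂ : ∀ a M S q c → M * (suc a * S + q * c) ≡ suc a * (M * S) + M * q * c
  regroup₂ = solve-∀

[k+1]*[n+1]C[k+1]≡[n+1]*nCk : ∀ n k → suc k * (suc n C suc k) ≡ suc n * (n C k)
[k+1]*[n+1]C[k+1]≡[n+1]*nCk zero    zero    = refl
[k+1]*[n+1]C[k+1]≡[n+1]*nCk zero    (suc k) = *-zeroʳ (suc (suc k))
[k+1]*[n+1]C[k+1]≡[n+1]*nCk (suc n) zero    =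
  trans (+-identityʳ _) (trans (nC1≡n (suc (suc n))) (sym (*-identityʳ _)))
[k+1]*[n+1]C[k+1]≡[n+1]*nCk (suc n) (suc k) = begin
  suc (suc k) * (suc (suc n) C suc (suc k))
    ≡⟨ cong (suc (suc k) *_) (sym (nCk+nC[k+1]≡[n+1]C[k+1] (suc n) (suc k))) ⟩
  suc (suc k) * (X + suc n C suc (suc k))
    ≡⟨ *-distribˡ-+ (suc (suc k)) X (suc n C suc (suc k)) ⟩
  (X + suc k * X) + suc (suc k) * (suc n C suc (suc k))
    ≡⟨ cong₂ (λ y z → (X + y) + z) ([k+1]*[n+1]C[k+1]≡[n+1]*nCk n k) ([k+1]*[n+1]C[k+1]≡[n+1]*nCk n (suc k)) ⟩
  (X + suc n * (n C k)) + suc n * (n C suc k)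
    ≡⟨ trans (+-assoc X _ _) (cong (X +_) (sym (*-distribˡ-+ (suc n) (n C k) (n C suc k)))) ⟩
  X + suc n * (n C k + n C suc k)
    ≡⟨ cong (λ y → X + suc n * y) (nCk+nC[k+1]≡[n+1]C[k+1] n k) ⟩
  suc (suc n) * X ∎
  where
  open ≡-Reasoning
  X = suc n C suc k

n*nCk≡k*nCk+[k+1]*nC[k+1] : ∀ n k → n * (n C k) ≡ k * (n C k) + suc k * (n C suc k)
n*nCk≡k*nCk+[k+1]*nC[k+1] zero    zero    = refl
n*nCk≡k*nCk+[k+1]*nC[k+1] zero    (suc k) = sym (cong₂ _+_ (*-zeroʳ (suc k)) (*-zeroʳ (suc (suc k))))
n*nCk≡k*nCk+[k+1]*nC[k+1] (suc n) zero    =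
  trans (*-identityʳ (suc n)) (sym (trans ([k+1]*[n+1]C[k+1]≡[n+1]*nCk n 0) (*-identityʳ (suc n))))
n*nCk≡k*nCk+[k+1]*nC[k+1] (suc n) (suc k) = begin
  suc n * (suc n C suc k)
    ≡⟨ cong (suc n *_) (sym (nCk+nC[k+1]≡[n+1]C[k+1] n k)) ⟩
  suc n * (n C k + n C suc k)
    ≡⟨ *-distribˡ-+ (suc n) (n C k) (n C suc k) ⟩
  suc n * (n C k) + suc n * (n C suc k)
    ≡⟨ sym (cong₂ _+_ ([k+1]*[n+1]C[k+1]≡[n+1]*nCk n k) ([k+1]*[n+1]C[k+1]≡[n+1]*nCk n (suc k))) ⟩
  suc k * (suc n C suc k) + suc (suc k) * (suc n C suc (suc k)) ∎
  where open ≡-Reasoning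

binomial-step : ∀ {n} k e → n ≡ suc (k + k + e) →
                suc n * (n C suc k) ≡ suc n * (n C k) + e * (n C k + n C suc k)
binomial-step {n} k e refl = begin
  suc n * Y                          ≡⟨ regroup-left k e Y ⟩
  suc k * Y + suc k * Y + e * Y      ≡⟨ cong (λ z → z + z + e * Y) absorbed ⟩
  (suc k * X + e * X) + (suc k * X + e * X) + e * Y
                                     ≡⟨ regroup-right k e X Y ⟩
  suc n * X + e * (X + Y)            ∎
  where
  open ≡-Reasoning
  X = n C k
  Y = n C suc k
  regroup-left : ∀ k e y → suc (suc (k + k + e)) * y ≡ suc k * y + suc k * y + e * y
  regroup-left = solve-∀
  regroup-right : ∀ k e x y → (suc k * x + e * x) + (suc k * x + e * x) + e * y
                              ≡ suc (suc (k + k + e)) * x + e * (x + y)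
  regroup-right = solve-∀
  split : ∀ k e x → suc (k + k + e) * x ≡ k * x + (suc k * x + e * x)
  split = solve-∀
  absorbed : suc k * Y ≡ suc k * X + e * X
  absorbed = +-cancelˡ-≡ (k * X) _ _
    (trans (sym (n*nCk≡k*nCk+[k+1]*nC[k+1] n k)) (split k e X))

nCk≤nC[k+1] : ∀ {n} k → suc (k + k) ≤ n → n C k ≤ n C suc k
nCk≤nC[k+1] {n} k 1+2k≤n = *-cancelˡ-≤ (suc n) (begin
  suc n * (n C k)                                ≤⟨ m≤m+n _ _ ⟩
  suc n * (n C k) + e * (n C k + n C suc k)      ≡⟨ sym (binomial-step k e (sym (m+[n∸m]≡n 1+2k≤n))) ⟩
  suc n * (n C suc k)                            ∎)
  where
  open ≤-Reasoning
  e = n ∸ suc (k + k)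

nCk≤nC[k+j] : ∀ {n} k j → (k + j) + (k + j) ≤ n → n C k ≤ n C (k + j)
nCk≤nC[k+j] {n} k zero    _  = ≤-reflexive (cong (n C_) (sym (+-identityʳ k)))
nCk≤nC[k+j] {n} k (suc j) le = begin
  n C k              ≤⟨ nCk≤nC[k+j] k j (≤-trans (+-mono-≤ (n≤1+n _) (n≤1+n _)) 1+k'+1+k'≤n) ⟩
  n C (k + j)        ≤⟨ nCk≤nC[k+1] (k + j) (≤-trans (n≤1+n _) (≤-trans (≤-reflexive (sym (1+m+1+m≡2+m+m (k + j)))) 1+k'+1+k'≤n)) ⟩
  n C suc (k + j)    ≡⟨ cong (n C_) (sym (+-suc k j)) ⟩
  n C (k + suc j)    ∎
  where
  open ≤-Reasoning
  1+k'+1+k'≤n : suc (k + j) + suc (k + j) ≤ n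
  1+k'+1+k'≤n = subst (λ t → t + t ≤ n) (+-suc k j) le

nCk≤nC[n/2] : ∀ {n} k → k + k ≤ n → n C k ≤ n C (n / 2)
nCk≤nC[n/2] {n} k 2k≤n = subst (λ t → n C k ≤ n C t) (m+[n∸m]≡n k≤n/2)
  (nCk≤nC[k+j] k (n / 2 ∸ k) (subst (λ t → t + t ≤ n) (sym (m+[n∸m]≡n k≤n/2)) (m/2+m/2≤m n)))
  where
  k≤n/2 : k ≤ n / 2
  k≤n/2 = m+m≤1+n+n⇒m≤n (≤-trans 2k≤n (m≤1+m/2+m/2 n))

binomial-growth-near-centre : ∀ {n} R k j → (k + j) + (k + j) ≤ n → n ≤ suc (k + k + (R + R)) →
  suc n * (n C (k + j)) ≤ suc n * (n C k) + j * (4 * R * (n C (n / 2)))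
binomial-growth-near-centre {n} R k zero _ _ = begin
  suc n * (n C (k + 0))   ≡⟨ cong (λ t → suc n * (n C t)) (+-identityʳ k) ⟩
  suc n * (n C k)         ≤⟨ m≤m+n _ _ ⟩
  suc n * (n C k) + 0     ∎
  where open ≤-Reasoning
binomial-growth-near-centre {n} R k (suc j) le n≤ = begin
  suc n * (n C (k + suc j))                    ≡⟨ cong (λ t → suc n * (n C t)) (+-suc k j) ⟩
  suc n * (n C suc k')                         ≡⟨ binomial-step k' e (sym (m+[n∸m]≡n 1+2k'≤n)) ⟩
  suc n * (n C k') + e * (n C k' + n C suc k')
    ≤⟨ +-mono-≤ (binomial-growth-near-centre R k j 2k'≤n n≤) (*-mono-≤ e≤2R (+-mono-≤ (nCk≤nC[n/2] k' 2k'≤n) (nCk≤nC[n/2] (suc k') 2[k'+1]≤n))) ⟩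
  suc n * (n C k) + j * (4 * R * c) + (R + R) * (c + c)
    ≡⟨ regroup (suc n * (n C k)) j R c ⟩
  suc n * (n C k) + suc j * (4 * R * c)        ∎
  where
  open ≤-Reasoning
  k' = k + j
  c = n C (n / 2)
  e = n ∸ suc (k' + k')
  2[k'+1]≤n : suc k' + suc k' ≤ n
  2[k'+1]≤n = subst (λ t → t + t ≤ n) (+-suc k j) le
  1+2k'≤n : suc (k' + k') ≤ n
  1+2k'≤n = ≤-trans (n≤1+n _) (≤-trans (≤-reflexive (sym (1+m+1+m≡2+m+m k'))) 2[k'+1]≤n)
  2k'≤n : k' + k' ≤ n
  2k'≤n = ≤-trans (n≤1+n _) 1+2k'≤n
  e≤2R : e ≤ R + R
  e≤2R = m≤n+o⇒m∸n≤o n (suc (k' + k'))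
    (≤-trans n≤ (s≤s (+-monoˡ-≤ (R + R) (+-mono-≤ (m≤m+n k j) (m≤m+n k j)))))
  regroup : ∀ a j R c → a + j * (4 * R * c) + (R + R) * (c + c) ≡ a + suc j * (4 * R * c)
  regroup = solve-∀

lower-layer-estimate : ∀ {n} r i i' → i + i' ≡ n → i ≤ i' → i' ≤ i + r →
  suc n * (n C (n / 2)) ≤ suc n * (n C i) + r * (4 * r * (n C (n / 2)))
lower-layer-estimate {n} r i i' refl i≤i' i'≤i+r = begin
  suc n * (n C h)                        ≡⟨ cong (λ t → suc n * (n C t)) (sym (m+[n∸m]≡n i≤h)) ⟩
  suc n * (n C (i + (h ∸ i)))            ≤⟨ binomial-growth-near-centre r i (h ∸ i) 2h≤n n≤2i+2r+1 ⟩
  suc n * (n C i) + (h ∸ i) * E          ≤⟨ +-monoʳ-≤ (suc n * (n C i)) (*-monoˡ-≤ E (m≤n+o⇒m∸n≤o h i h≤i+r)) ⟩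
  suc n * (n C i) + r * E                ∎
  where
  open ≤-Reasoning
  h = n / 2
  E = 4 * r * (n C h)
  n≤2i+r : n ≤ i + (i + r)
  n≤2i+r = +-monoʳ-≤ i i'≤i+r
  i≤h : i ≤ h
  i≤h = m+m≤1+n+n⇒m≤n (≤-trans (+-monoʳ-≤ i i≤i') (m≤1+m/2+m/2 n))
  h≤i+r : h ≤ i + r
  h≤i+r = m+m≤1+n+n⇒m≤n (≤-trans (m/2+m/2≤m n)
            (≤-trans n≤2i+r (≤-trans (+-monoˡ-≤ (i + r) (m≤m+n i r)) (n≤1+n _))))
  2h≤n : (i + (h ∸ i)) + (i + (h ∸ i)) ≤ n
  2h≤n = subst (λ t → t + t ≤ n) (sym (m+[n∸m]≡n i≤h)) (m/2+m/2≤m n)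
  n≤2i+2r+1 : n ≤ suc (i + i + (r + r))
  n≤2i+2r+1 = ≤-trans n≤2i+r (≤-trans (≤-reflexive (sym (+-assoc i i r)))
                (≤-trans (+-monoʳ-≤ (i + i) (m≤n+m r r)) (n≤1+n _)))

balanced-layer-estimate : ∀ {n} r i i' → i + i' ≡ n → i ≤ i' + r → i' ≤ i + r →
  suc n * (n C (n / 2)) ≤ suc n * (n C i) + r * (4 * r * (n C (n / 2)))
balanced-layer-estimate {n} r i i' i+i'≡n i≤i'+r i'≤i+r with ≤-total i i'
... | inj₁ i≤i' = lower-layer-estimate r i i' i+i'≡n i≤i' i'≤i+r
... | inj₂ i'≤i = subst (λ t → suc n * (n C (n / 2)) ≤ suc n * t + r * (4 * r * (n C (n / 2)))) nCi'≡nCi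
                    (lower-layer-estimate r i' i (trans (+-comm i' i) i+i'≡n) i'≤i i≤i'+r)
  where
  nCi'≡nCi : n C i' ≡ n C i
  nCi'≡nCi = begin
    n C i'             ≡⟨ cong (n C_) (sym (trans (cong (_∸ i) (sym i+i'≡n)) (m+n∸m≡n i i'))) ⟩
    n C (n ∸ i)        ≡⟨ sym (nCk≡nC[n∸k] (subst (i ≤_) i+i'≡n (m≤m+n i i'))) ⟩
    n C i              ∎
    where open ≡-Reasoning

layer : ∀ n → ℕ → List (Subset n)
layer n       zero    = ⊥ ∷ []
layer zero    (suc k) = []
layer (suc n) (suc k) = map (inside ∷_) (layer n k) ++ map (outside ∷_) (layer n (suc k))

∈-layer⇒∣p∣≡k : ∀ n k {p} → p ∈ layer n k → ∣ p ∣ ≡ k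
∈-layer⇒∣p∣≡k n       zero    (here refl) = ∣⊥∣≡0 n
∈-layer⇒∣p∣≡k (suc n) (suc k) p∈ with ∈-++⁻ (map (inside ∷_) (layer n k)) p∈
... | inj₁ p∈ˡ with ∈-map⁻ _ p∈ˡ
...   | _ , q∈ , refl = cong suc (∈-layer⇒∣p∣≡k n k q∈)
∈-layer⇒∣p∣≡k (suc n) (suc k) p∈ | inj₂ p∈ʳ with ∈-map⁻ _ p∈ʳ
...   | _ , q∈ , refl = ∈-layer⇒∣p∣≡k n (suc k) q∈

layer-unique : ∀ n k → Unique (layer n k)
layer-unique n       zero    = [] ∷ []
layer-unique zero    (suc k) = []
layer-unique (suc n) (suc k) =
  Unique.++⁺ (Unique.map⁺ ∷-injectiveʳ (layer-unique n k)) (Unique.map⁺ ∷-injectiveʳ (layer-unique n (suc k))) disjoint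
  where
  disjoint : ∀ {p} → ¬ (p ∈ map (inside ∷_) (layer n k) × p ∈ map (outside ∷_) (layer n (suc k)))
  disjoint (p∈ˡ , p∈ʳ) with ∈-map⁻ _ p∈ˡ | ∈-map⁻ _ p∈ʳ
  ... | _ , _ , refl | _ , _ , ()

length-layer : ∀ n k → length (layer n k) ≡ n C k
length-layer n       zero    = refl
length-layer zero    (suc k) = refl
length-layer (suc n) (suc k) = begin
  length (map (inside ∷_) (layer n k) ++ map (outside ∷_) (layer n (suc k)))
    ≡⟨ length-++ (map (inside ∷_) (layer n k)) ⟩
  length (map (inside ∷_) (layer n k)) + length (map (outside ∷_) (layer n (suc k)))
    ≡⟨ cong₂ _+_ (length-map _ (layer n k)) (length-map _ (layer n (suc k))) ⟩
  length (layer n k) + length (layer n (suc k))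
    ≡⟨ cong₂ _+_ (length-layer n k) (length-layer n (suc k)) ⟩
  n C k + n C suc k
    ≡⟨ nCk+nC[k+1]≡[n+1]C[k+1] n k ⟩
  suc n C suc k ∎
  where open ≡-Reasoning

layers : ∀ n → ℕ → ℕ → List (Subset n)
layers n s zero    = []
layers n s (suc r) = layer n s ++ layers n (suc s) r

∈-layers⇒s≤∣p∣<s+r : ∀ n s r {p} → p ∈ layers n s r → s ≤ ∣ p ∣ × ∣ p ∣ < s + r
∈-layers⇒s≤∣p∣<s+r n s (suc r) {p} p∈ with ∈-++⁻ (layer n s) p∈
... | inj₁ p∈ˡ rewrite ∈-layer⇒∣p∣≡k n s p∈ˡ = ≤-refl , m<m+n s (s≤s z≤n)
... | inj₂ p∈ʳ with ∈-layers⇒s≤∣p∣<s+r n (suc s) r p∈ʳ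
...   | s<∣p∣ , ∣p∣<1+s+r = <⇒≤ s<∣p∣ , subst (∣ p ∣ <_) (sym (+-suc s r)) ∣p∣<1+s+r

layers-unique : ∀ n s r → Unique (layers n s r)
layers-unique n s zero    = []
layers-unique n s (suc r) = Unique.++⁺ (layer-unique n s) (layers-unique n (suc s) r) disjoint
  where
  disjoint : ∀ {p} → ¬ (p ∈ layer n s × p ∈ layers n (suc s) r)
  disjoint (p∈ˡ , p∈ʳ) with ∈-layer⇒∣p∣≡k n s p∈ˡ | ∈-layers⇒s≤∣p∣<s+r n (suc s) r p∈ʳ
  ... | refl | s<s , _ = <-irrefl refl s<s

length-layers-bound : ∀ {n a b e} s r → (∀ i → s ≤ i → i < s + r → a ≤ b * (n C i) + e) →
  r * a ≤ b * length (layers n s r) + r * e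
length-layers-bound s zero    _     = z≤n
length-layers-bound {n} {a} {b} {e} s (suc r) bound = begin
  a + r * a
    ≤⟨ +-mono-≤ (bound s ≤-refl (m<m+n s (s≤s z≤n)))
                (length-layers-bound {n} {a} {b} {e} (suc s) r (λ i s<i i<1+s+r → bound i (<⇒≤ s<i) (subst (i <_) (sym (+-suc s r)) i<1+s+r))) ⟩
  (b * (n C s) + e) + (b * length (layers n (suc s) r) + r * e)
    ≡⟨ cong (λ t → (b * t + e) + (b * length (layers n (suc s) r) + r * e)) (sym (length-layer n s)) ⟩
  (b * length (layer n s) + e) + (b * length (layers n (suc s) r) + r * e)
    ≡⟨ regroup b (length (layer n s)) e (length (layers n (suc s) r)) r ⟩
  b * (length (layer n s) + length (layers n (suc s) r)) + suc r * e
    ≡⟨ cong (λ t → b * t + suc r * e) (sym (length-++ (layer n s))) ⟩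
  b * length (layers n s (suc r)) + suc r * e ∎
  where
  open ≤-Reasoning
  regroup : ∀ b x e y r → (b * x + e) + (b * y + r * e) ≡ b * (x + y) + suc r * e
  regroup = solve-∀

p⊆q⇒∣p∣≡∣q∣⇒p≡q : ∀ {n} {p q : Subset n} → p ⊆ q → ∣ p ∣ ≡ ∣ q ∣ → p ≡ q
p⊆q⇒∣p∣≡∣q∣⇒p≡q {p = []}          {[]}          _   _ = refl
p⊆q⇒∣p∣≡∣q∣⇒p≡q {p = outside ∷ p} {outside ∷ q} p⊆q eq = cong (outside ∷_) (p⊆q⇒∣p∣≡∣q∣⇒p≡q (drop-∷-⊆ p⊆q) eq)
p⊆q⇒∣p∣≡∣q∣⇒p≡q {p = outside ∷ p} {inside  ∷ q} p⊆q eq = contradiction eq (<⇒≢ (s≤s (p⊆q⇒∣p∣≤∣q∣ (drop-∷-⊆ p⊆q))))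
p⊆q⇒∣p∣≡∣q∣⇒p≡q {p = inside  ∷ p} {outside ∷ q} p⊆q eq with p⊆q here
... | ()
p⊆q⇒∣p∣≡∣q∣⇒p≡q {p = inside  ∷ p} {inside  ∷ q} p⊆q eq = cong (inside ∷_) (p⊆q⇒∣p∣≡∣q∣⇒p≡q (drop-∷-⊆ p⊆q) (suc-injective eq))

middleLayers : ∀ r n → Family n
middleLayers r n = record
  { members  = layers n ((n + 1 ∸ r) / 2) r
  ; distinct = layers-unique n ((n + 1 ∸ r) / 2) r
  }

-- Membership in these layers is InMiddleLayers r n by definition, so a rainbow copy is a LayeredCopy.
middleLayers-admissible : ∀ {P} r → ReGood P r → ∀ n → Admissible P (middleLayers r n)
middleLayers-admissible {P} r good n = ∣_∣ , proper , no-rainbow-copy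
  where
  proper : Proper (middleLayers r n) ∣_∣
  proper _ _ (p⊆q , p≢q) ∣p∣≡∣q∣ = p≢q (p⊆q⇒∣p∣≡∣q∣⇒p≡q p⊆q ∣p∣≡∣q∣)
  no-rainbow-copy : ∀ f → IsCopy P (λ p → p ∈ members (middleLayers r n)) f → ¬ Rainbow ∣_∣ f
  no-rainbow-copy f (injective , f∈ , iso) rainbow =
    good n (f , (injective , (λ i → ∈-layers⇒s≤∣p∣<s+r n _ r (f∈ i)) , iso) , rainbow)

middle-layer-estimate : ∀ {n r i} → r ≤ suc n → (n + 1 ∸ r) / 2 ≤ i → i < (n + 1 ∸ r) / 2 + r →
  suc n * (n C (n / 2)) ≤ suc n * (n C i) + r * (4 * r * (n C (n / 2)))
middle-layer-estimate {n} {r} {i} r≤1+n s≤i i<s+r = balanced-layer-estimate r i (n ∸ i) i+i'≡n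
  (+-cancelˡ-≤ i _ _ (≤-trans 2i≤n+r (≤-reflexive (trans (cong (_+ r) (sym i+i'≡n)) (+-assoc i (n ∸ i) r)))))
  (+-cancelˡ-≤ i _ _ (≤-trans (≤-reflexive i+i'≡n) (≤-trans n≤2i+r (≤-reflexive (+-assoc i i r)))))
  where
  open ≤-Reasoning
  x = n + 1 ∸ r
  s = x / 2
  x+r≡1+n : x + r ≡ suc n
  x+r≡1+n = trans (m∸n+n≡m (subst (r ≤_) (+-comm 1 n) r≤1+n)) (+-comm n 1)
  n≤2i+r : n ≤ i + i + r
  n≤2i+r = s≤s⁻¹ (begin
    suc n                 ≡⟨ sym x+r≡1+n ⟩
    x + r                 ≤⟨ +-monoˡ-≤ r (m≤1+m/2+m/2 x) ⟩
    suc (s + s) + r       ≤⟨ +-monoˡ-≤ r (s≤s (+-mono-≤ s≤i s≤i)) ⟩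
    suc (i + i + r)       ∎)
  2i≤n+r : i + i ≤ n + r
  2i≤n+r = ≤-trans (n≤1+n _) (s≤s⁻¹ (begin
    suc (suc (i + i))     ≡⟨ sym (1+m+1+m≡2+m+m i) ⟩
    suc i + suc i         ≤⟨ +-mono-≤ i<s+r i<s+r ⟩
    (s + r) + (s + r)     ≡⟨ regroup s r ⟩
    (s + s) + r + r       ≤⟨ +-monoˡ-≤ r (+-monoˡ-≤ r (m/2+m/2≤m x)) ⟩
    x + r + r             ≡⟨ cong (_+ r) x+r≡1+n ⟩
    suc (n + r)           ∎))
    where
    regroup : ∀ s r → (s + r) + (s + r) ≡ (s + s) + r + r
    regroup = solve-∀
  i≤n : i ≤ n
  i≤n = m+m≤1+n+n⇒m≤n (≤-trans 2i≤n+r (≤-trans (+-monoʳ-≤ n r≤1+n) (≤-reflexive (+-suc n n))))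
  i+i'≡n : i + (n ∸ i) ≡ n
  i+i'≡n = m+[n∸m]≡n i≤n

middleLayers-size-bound : ∀ r {n} → r ≤ suc n →
  r * (suc n * (n C (n / 2))) ≤ suc n * ∣ middleLayers r n ∣F + r * (r * (4 * r)) * (n C (n / 2))
middleLayers-size-bound r {n} r≤1+n = subst (r * (suc n * c) ≤_) (cong (suc n * ∣ middleLayers r n ∣F +_) (regroup r c))
  (length-layers-bound {n} {suc n * c} {suc n} {r * (4 * r * c)} ((n + 1 ∸ r) / 2) r (λ i s≤i i<s+r → middle-layer-estimate r≤1+n s≤i i<s+r))
  where
  c = n C (n / 2)
  regroup : ∀ r c → r * (r * (4 * r * c)) ≡ r * (r * (4 * r)) * c
  regroup = solve-∀

proposition1p1 : ∀ (P : FinPoset) (r : ℕ) → IsReStar P r →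
    ∀ (m : ℕ) → ∃ λ N → ∀ n → N ≤ n → ∀ L → IsLaStar n P L →
      suc m * r * (n C (n / 2)) ≤ suc m * L + n C (n / 2)
proposition1p1 P r (_ , good , _) m = N , bound
  where
  N = r + suc m * (r * (r * (4 * r)))
  bound : ∀ n → N ≤ n → ∀ L → IsLaStar n P L → suc m * r * (n C (n / 2)) ≤ suc m * L + n C (n / 2)
  bound n N≤n L (_ , maximal) = cancel-small-error {a = n} {r = r} {M = suc m} {q = r * (r * (4 * r))}
    (middleLayers-size-bound r (≤-trans (m≤m+n r _) N≤1+n))
    (≤-trans (m≤n+m _ r) N≤1+n)
    (maximal (middleLayers r n) (middleLayers-admissible {P} r good n))
    where
    N≤1+n : N ≤ suc n
    N≤1+n = ≤-trans N≤n (n≤1+n n)
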